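{- Let $k,l\ge 1$. Let $P$ be a directed path in the graph $\mathcal{G}_{\infty,\infty}$ starting at the root $(0,0)$ that consists of $l$ horizontal edges followed by $k$ vertical edges. Let $X=x_1\cdots x_l\in\{D,C\}^l$ be the word of labels of the horizontal part and $Y=y_1\cdots y_k\in\{D',B\}^k$ the word of labels of the vertical part. Let $H=h_1\cdots h_l$ be the image of $X$ under one of the two letter-to-letter maps $(D\mapsto d,\ C\mapsto c)$ or $(D\mapsto b,\ C\mapsto a)$, and let $V=v_1\cdots v_k$ be the image of $Y$ under one of the two maps $(D'\mapsto d,\ B\mapsto b)$ or $(D'\mapsto c,\ B\mapsto a)$, where these choices are made so that $h_l=v_1$. Let $\theta$ be the letter-to-letter substitution $\theta(a)=c,\theta(b)=d,\theta(c)=a,\theta(d)=b$. Define the $k\times l$ array $u$ whose first row is $H$ and whose $r$-th row, for $2\le r\le k$, is $H$ if $v_r=v_1$ and $\theta(H)$ otherwise. Then $u$ is a factor of $f_{\infty,\infty}$ of size $(k,l)$.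
   Context: Alphabet $\{a,b,c,d\}$. The $2D$ infinite Fibonacci word $f_{\infty,\infty}=[f(i,j)]_{i,j\ge1}$ is the fixed point $\lim_{n\to\infty}\mu^n(d)$ of the $2D$ morphism $\mu$ given by $d\mapsto\begin{smallmatrix}d&c\\ b&a\end{smallmatrix}$, $c\mapsto\begin{smallmatrix}d\\ b\end{smallmatrix}$, $b\mapsto\begin{smallmatrix}d&c\end{smallmatrix}$, $a\mapsto d$. Equivalently, if $x=x_1x_2\cdots=101101011\cdots$ is the fixed point of $1\mapsto10,\ 0\mapsto1$, then $f(i,j)=d,c,b,a$ according as $(x_i,x_j)=(1,1),(1,0),(0,1),(0,0)$. A factor of size $(k,l)$ of $f_{\infty,\infty}$ is a $k\times l$ array ($k$ rows, $l$ columns) equal to the block of $f_{\infty,\infty}$ in rows $i+1,\dots,i+k$ and columns $j+1,\dots,j+l$ for some $i,j\ge0$. Let $F(0)=1,F(1)=2,F(n)=F(n-1)+F(n-2)$. Let $w_{\rm row}=w_{\rm row}(1)w_{\rm row}(2)\cdots=DCDDCDCD\cdots$ be the image of $x$ under $1\mapsto D,0\mapsto C$, and $w_{\rm col}=D'BD'D'BD'BD'\cdots$ its image under $1\mapsto D',0\mapsto B$. The graph $\mathcal{G}_{\infty,\infty}$ has vertex set $\{(i,j): i,j\ge0\}$, root $(0,0)$, and the following labelled directed edges. Horizontal edges: for $j\ge1$, $(0,j-1)\to(0,j)$ labelled $w_{\rm row}(j)$, and $(0,F(j)-2)\to(0,F(j+1)-1)$ labelled $D$ if $j$ is even and $C$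 if $j$ is odd. Vertical edges: for every $j\ge0$ and $i\ge1$, $(i-1,j)\to(i,j)$ labelled $w_{\rm col}(i)$, and $(F(i)-2,j)\to(F(i+1)-1,j)$ labelled $D'$ if $i$ is even and $B$ if $i$ is odd. (This is the rooted product of the directed acyclic word graphs of $w_{\rm row}$ and $w_{\rm col}$.) -}

module Defs where

open import Data.Nat using (ℕ; zero; suc; _+_; _∸_; _≤_)
open import Data.Bool using (Bool; true; false; if_then_else_)
open import Data.List using (List; []; _∷_; _++_)
open import Data.Vec using (Vec; []; _∷_; lookup)
open import Data.Fin using (Fin; toℕ) renaming (zero to fzero; suc to fsuc)
open import Data.Product using (_×_; _,_; ∃; ∃-syntax)
open import Relation.Binary.PropositionalEquality using (_≡_)

-- The Fibonacci word x = x₁x₂⋯ = 101101011⋯ (fixed point of 1↦10, 0↦1),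
-- with true = 1, false = 0.

fibMorph : List Bool → List Bool
fibMorph [] = []
fibMorph (true ∷ w) = true ∷ false ∷ fibMorph w
fibMorph (false ∷ w) = true ∷ fibMorph w

-- fibIter n = φⁿ(1), a prefix of x of length F(n) ≥ n + 1.
fibIter : ℕ → List Bool
fibIter zero = true ∷ []
fibIter (suc n) = fibMorph (fibIter n)

-- 0-based lookup in a list, default false (never used below, since
-- fibIter i has length ≥ i + 1).
nth : List Bool → ℕ → Bool
nth [] _ = false
nth (b ∷ w) zero = b
nth (b ∷ w) (suc n) = nth w n

-- xAt i = x_i for i ≥ 1 (1-based, as in the paper); xAt 0 is junk.
xAt : ℕ → Bool
xAt i = nth (fibIter i) (i ∸ 1)

data Letter : Set where
  a b c d : Letter

fAt : ℕ → ℕ → Letter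
fAt i j with xAt i | xAt j
... | true  | true  = d
... | true  | false = c
... | false | true  = b
... | false | false = a

θ : Letter → Letter
θ a = c
θ b = d
θ c = a
θ d = b

_==L_ : Letter → Letter → Bool
a ==L a = true
b ==L b = true
c ==L c = true
d ==L d = true
_ ==L _ = false

F : ℕ → ℕ
F zero = 1
F (suc zero) = 2
F (suc (suc n)) = F (suc n) + F n

isEven : ℕ → Bool
isEven zero = true
isEven (suc zero) = false
isEven (suc (suc n)) = isEven n

data RowL : Set where
  D C : RowL

data ColL : Set where
  D' B : ColL

wrow : ℕ → RowL
wrow j = if xAt j then D else C

wcol : ℕ → ColL
wcol i = if xAt i then D' else B

Vertex : Set
Vertex = ℕ × ℕ

data HEdge : Vertex → Vertex → RowL → Set where
  hstep : ∀ j → HEdge (0 , j) (0 , suc j) (wrow (suc j))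
  hjump : ∀ j → 1 ≤ j →
          HEdge (0 , F j ∸ 2) (0 , F (suc j) ∸ 1) (if isEven j then D else C)

data VEdge : Vertex → Vertex → ColL → Set where
  vstep : ∀ i j → VEdge (i , j) (suc i , j) (wcol (suc i))
  vjump : ∀ i j → 1 ≤ i →
          VEdge (F i ∸ 2 , j) (F (suc i) ∸ 1 , j) (if isEven i then D' else B)

data HWalk : Vertex → Vertex → {n : ℕ} → Vec RowL n → Set where
  hnil  : ∀ {u} → HWalk u u []
  hcons : ∀ {u v w n x} {xs : Vec RowL n} →
          HEdge u v x → HWalk v w xs → HWalk u w (x ∷ xs)

data VWalk : Vertex → Vertex → {n : ℕ} → Vec ColL n → Set where
  vnil  : ∀ {u} → VWalk u u []
  vcons : ∀ {u v w n y} {ys : Vec ColL n} →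
          VEdge u v y → VWalk v w ys → VWalk u w (y ∷ ys)

hMap : Bool → RowL → Letter
hMap true  D = d
hMap true  C = c
hMap false D = b
hMap false C = a

vMap : Bool → ColL → Letter
vMap true  D' = d
vMap true  B  = b
vMap false D' = c
vMap false B  = a

-- Arrays are functions Fin rows → Fin cols → Letter (0-based indices).

arrayU : ∀ {k l} → Vec Letter l → Vec Letter (suc k) → Fin (suc k) → Fin l → Letter
arrayU H V fzero s = lookup H s
arrayU {k} H (v₁ ∷ vs) (fsuc r) s =
  if lookup vs r ==L v₁ then lookup H s else θ (lookup H s)

IsFactor : (k l : ℕ) → (Fin k → Fin l → Letter) → Set
IsFactor k l u = ∃[ i ] ∃[ j ] (∀ (r : Fin k) (s : Fin l) →
                   u r s ≡ fAt (i + suc (toℕ r)) (j + suc (toℕ s)))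

{-# OPTIONS --safe #-}
-- A walk in the word graph of w_row spells the factor of w_row ending at the column the
-- walk reaches: a step edge appends the next letter, and a jump edge
-- (0, F(j)−2) → (0, F(j+1)−1) is sound because the prefix of x of length F(j)−2 recurs at
-- offset F(j−1), where it is followed by x_{F(j+1)−1} = [j even]. Both facts say that
-- s_{n+1}s_n and s_n s_{n+1} (s_n = φⁿ(1)) agree except in their last two letters.
-- The same holds for vertical walks, so X and Y read x from some column p+1 and row q+1 on.
-- As f(i,j) is the letter with bits (x_i, x_j) and θ flips the row bit, the condition
-- h_l = v_1 forces the row bit of H to be x_{q+1}, and then row r of u is the letter row
-- of x_{q+r}: u is the block of f at rows q+1.. and columns p+1.. .
module Submission where

open import Defs
open import Data.Nat using (ℕ; suc; zero; _+_; _∸_; _≤_; _<_; s≤s; z≤n)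
open import Data.Nat.Properties
open import Data.Bool using (Bool; true; false; not; if_then_else_)
open import Data.List using (List; []; _∷_; _++_; _∷ʳ_; length; applyUpTo)
open import Data.List.Properties using (length-++; ++-assoc; ++-identityʳ; ∷ʳ-++; applyUpTo-∷ʳ; ∷-injectiveˡ; ∷-injectiveʳ)
open import Data.Vec using (Vec; map; last; head; lookup; toList; _∷_; [])
open import Data.Vec.Properties using (lookup-map)
open import Data.Fin using (Fin; toℕ; fromℕ) renaming (zero to fzero; suc to fsuc)
open import Data.Product using (_,_; _×_; proj₁; proj₂; ∃-syntax)
open import Function using (_∘_)
open import Relation.Binary.PropositionalEquality
open ≡-Reasoning

F-≤-suc : ∀ n → F n ≤ F (suc n)
F-≤-suc zero = s≤s z≤n
F-≤-suc (suc n) = m≤m+n (F (suc n)) (F n)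

n<F : ∀ n → n < F n
n<F zero = s≤s z≤n
n<F (suc zero) = s≤s (s≤s z≤n)
n<F (suc (suc n)) = subst (_≤ F (suc (suc n))) (+-comm (suc (suc n)) 1)
  (+-mono-≤ (n<F (suc n)) (≤-trans (s≤s z≤n) (n<F n)))

2≤F-suc : ∀ n → 2 ≤ F (suc n)
2≤F-suc n = ≤-trans (s≤s (s≤s z≤n)) (n<F (suc n))

fibMorph-++ : ∀ u v → fibMorph (u ++ v) ≡ fibMorph u ++ fibMorph v
fibMorph-++ [] v = refl
fibMorph-++ (true ∷ u) v = cong (λ w → true ∷ false ∷ w) (fibMorph-++ u v)
fibMorph-++ (false ∷ u) v = cong (true ∷_) (fibMorph-++ u v)

fibIter-suc-suc : ∀ n → fibIter (suc (suc n)) ≡ fibIter (suc n) ++ fibIter n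
fibIter-suc-suc zero = refl
fibIter-suc-suc (suc n) =
  trans (cong fibMorph (fibIter-suc-suc n)) (fibMorph-++ (fibIter (suc n)) (fibIter n))

length-fibIter : ∀ n → length (fibIter n) ≡ F n
length-fibIter zero = refl
length-fibIter (suc zero) = refl
length-fibIter (suc (suc n)) = begin
  length (fibIter (suc (suc n)))                ≡⟨ cong length (fibIter-suc-suc n) ⟩
  length (fibIter (suc n) ++ fibIter n)         ≡⟨ length-++ (fibIter (suc n)) ⟩
  length (fibIter (suc n)) + length (fibIter n) ≡⟨ cong₂ _+_ (length-fibIter (suc n)) (length-fibIter n) ⟩
  F (suc (suc n))                               ∎

fibStem : ℕ → List Bool
fibStem zero = true ∷ []
fibStem (suc n) = fibIter (suc n) ++ fibStem n

fibIter-suc-++ : ∀ n → fibIter (suc n) ++ fibIter n ≡ fibStem n ++ isEven (suc n) ∷ isEven n ∷ []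
fibIter-++-suc : ∀ n → fibIter n ++ fibIter (suc n) ≡ fibStem n ++ isEven n ∷ isEven (suc n) ∷ []
fibIter-suc-++ zero = refl
fibIter-suc-++ (suc n) = begin
  fibIter (suc (suc n)) ++ fibIter (suc n)            ≡⟨ cong (_++ fibIter (suc n)) (fibIter-suc-suc n) ⟩
  (fibIter (suc n) ++ fibIter n) ++ fibIter (suc n)   ≡⟨ ++-assoc (fibIter (suc n)) (fibIter n) (fibIter (suc n)) ⟩
  fibIter (suc n) ++ (fibIter n ++ fibIter (suc n))   ≡⟨ cong (fibIter (suc n) ++_) (fibIter-++-suc n) ⟩
  fibIter (suc n) ++ (fibStem n ++ _)                 ≡⟨ ++-assoc (fibIter (suc n)) (fibStem n) _ ⟨
  fibStem (suc n) ++ isEven n ∷ isEven (suc n) ∷ []   ∎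
fibIter-++-suc zero = refl
fibIter-++-suc (suc n) = begin
  fibIter (suc n) ++ fibIter (suc (suc n))            ≡⟨ cong (fibIter (suc n) ++_) (fibIter-suc-suc n) ⟩
  fibIter (suc n) ++ (fibIter (suc n) ++ fibIter n)   ≡⟨ cong (fibIter (suc n) ++_) (fibIter-suc-++ n) ⟩
  fibIter (suc n) ++ (fibStem n ++ _)                 ≡⟨ ++-assoc (fibIter (suc n)) (fibStem n) _ ⟨
  fibStem (suc n) ++ isEven (suc n) ∷ isEven n ∷ []   ∎

length-fibStem : ∀ n → suc (suc (length (fibStem n))) ≡ F (suc (suc n))
length-fibStem n = begin
  suc (suc (length (fibStem n)))                       ≡⟨ +-comm 2 (length (fibStem n)) ⟩
  length (fibStem n) + 2                               ≡⟨ length-++ (fibStem n) ⟨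
  length (fibStem n ++ isEven (suc n) ∷ isEven n ∷ []) ≡⟨ cong length (fibIter-suc-++ n) ⟨
  length (fibIter (suc n) ++ fibIter n)                ≡⟨ cong length (fibIter-suc-suc n) ⟨
  length (fibIter (suc (suc n)))                       ≡⟨ length-fibIter (suc (suc n)) ⟩
  F (suc (suc n))                                      ∎

fibStem-length : ∀ n → length (fibStem n) ≡ F n + (F (suc n) ∸ 2)
fibStem-length n = begin
  length (fibStem n)                   ≡⟨ cong (_∸ 2) (length-fibStem n) ⟩
  F (suc (suc n)) ∸ 2                  ≡⟨ cong (_∸ 2) (+-comm (F (suc n)) (F n)) ⟩
  (F n + F (suc n)) ∸ 2                ≡⟨ +-∸-assoc (F n) (2≤F-suc n) ⟩
  F n + (F (suc n) ∸ 2)                ∎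

nth-++ˡ : ∀ u v {t} → t < length u → nth (u ++ v) t ≡ nth u t
nth-++ˡ (x ∷ u) v {zero} _ = refl
nth-++ˡ (x ∷ u) v {suc t} (s≤s t<u) = nth-++ˡ u v t<u

nth-++ʳ : ∀ u v t → nth (u ++ v) (length u + t) ≡ nth v t
nth-++ʳ [] v t = refl
nth-++ʳ (x ∷ u) v t = nth-++ʳ u v t

nth-fibIter-suc : ∀ n {p} → p < F n → nth (fibIter (suc n)) p ≡ nth (fibIter n) p
nth-fibIter-suc zero {zero} _ = refl
nth-fibIter-suc zero {suc p} (s≤s ())
nth-fibIter-suc (suc n) {p} p<F = trans (cong (λ w → nth w p) (fibIter-suc-suc n))
  (nth-++ˡ (fibIter (suc n)) (fibIter n) (subst (p <_) (sym (length-fibIter (suc n))) p<F))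

nth-fibIter-+ : ∀ k n {p} → p < F n → nth (fibIter (k + n)) p ≡ nth (fibIter n) p
nth-fibIter-+ zero n p<F = refl
nth-fibIter-+ (suc k) n {p} p<F = begin
  nth (fibIter (suc k + n)) p  ≡⟨ cong (λ m → nth (fibIter m) p) (+-suc k n) ⟨
  nth (fibIter (k + suc n)) p  ≡⟨ nth-fibIter-+ k (suc n) (<-≤-trans p<F (F-≤-suc n)) ⟩
  nth (fibIter (suc n)) p      ≡⟨ nth-fibIter-suc n p<F ⟩
  nth (fibIter n) p            ∎

fibWord : ℕ → Bool
fibWord p = xAt (suc p)

nth-fibIter : ∀ n {p} → p < F n → nth (fibIter n) p ≡ fibWord p
nth-fibIter n {p} p<F = begin
  nth (fibIter n) p            ≡⟨ nth-fibIter-+ (suc p) n p<F ⟨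
  nth (fibIter (suc p + n)) p  ≡⟨ cong (λ m → nth (fibIter m) p) (+-comm (suc p) n) ⟩
  nth (fibIter (n + suc p)) p  ≡⟨ nth-fibIter-+ n (suc p) (<-≤-trans (n<F p) (F-≤-suc p)) ⟩
  fibWord p                    ∎

fibStem-length<F : ∀ n → length (fibStem n) < F (suc (suc n))
fibStem-length<F n = subst (length (fibStem n) <_) (length-fibStem n) (n≤1+n _)

fibIter-suc-suc-stem : ∀ n → fibIter (suc (suc n)) ≡ fibStem n ++ isEven (suc n) ∷ isEven n ∷ []
fibIter-suc-suc-stem n = trans (fibIter-suc-suc n) (fibIter-suc-++ n)

nth-fibStem : ∀ n {q} → q < length (fibStem n) →
              nth (fibIter (suc (suc n))) q ≡ nth (fibIter n ++ fibIter (suc n)) q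
nth-fibStem n {q} q<ℓ = begin
  nth (fibIter (suc (suc n))) q          ≡⟨ cong (λ w → nth w q) (fibIter-suc-suc-stem n) ⟩
  nth (fibStem n ++ _) q                 ≡⟨ nth-++ˡ (fibStem n) _ q<ℓ ⟩
  nth (fibStem n) q                      ≡⟨ nth-++ˡ (fibStem n) _ q<ℓ ⟨
  nth (fibStem n ++ _) q                 ≡⟨ cong (λ w → nth w q) (fibIter-++-suc n) ⟨
  nth (fibIter n ++ fibIter (suc n)) q   ∎

fibWord-periodic : ∀ n {t} → t < F (suc n) ∸ 2 → fibWord t ≡ fibWord (F n + t)
fibWord-periodic n {t} t<F∸2 = begin
  fibWord t                                                     ≡⟨ nth-fibIter (suc n) t<F ⟨
  nth (fibIter (suc n)) t                                       ≡⟨ nth-++ʳ (fibIter n) (fibIter (suc n)) t ⟨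
  nth (fibIter n ++ fibIter (suc n)) (length (fibIter n) + t)   ≡⟨ cong (λ m → nth (fibIter n ++ fibIter (suc n)) (m + t)) (length-fibIter n) ⟩
  nth (fibIter n ++ fibIter (suc n)) (F n + t)                  ≡⟨ nth-fibStem n inStem ⟨
  nth (fibIter (suc (suc n))) (F n + t)                         ≡⟨ nth-fibIter (suc (suc n)) (<-trans inStem (fibStem-length<F n)) ⟩
  fibWord (F n + t)                                             ∎
  where
  t<F : t < F (suc n)
  t<F = <-≤-trans t<F∸2 (m∸n≤m (F (suc n)) 2)
  inStem : F n + t < length (fibStem n)
  inStem = subst (F n + t <_) (sym (fibStem-length n)) (+-monoʳ-< (F n) t<F∸2)

fibWord-boundary : ∀ n → fibWord (length (fibStem n)) ≡ isEven (suc n)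
fibWord-boundary n = begin
  fibWord ℓ                           ≡⟨ nth-fibIter (suc (suc n)) (fibStem-length<F n) ⟨
  nth (fibIter (suc (suc n))) ℓ       ≡⟨ cong (λ w → nth w ℓ) (fibIter-suc-suc-stem n) ⟩
  nth (fibStem n ++ _) ℓ              ≡⟨ cong (nth (fibStem n ++ _)) (+-identityʳ ℓ) ⟨
  nth (fibStem n ++ _) (ℓ + 0)        ≡⟨ nth-++ʳ (fibStem n) _ 0 ⟩
  isEven (suc n)                      ∎
  where
  ℓ : ℕ
  ℓ = length (fibStem n)

lookup-applyUpTo-toList : ∀ {A : Set} {n} (X : Vec A n) (f : ℕ → A) →
                          toList X ≡ applyUpTo f (length (toList X)) → ∀ r → lookup X r ≡ f (toℕ r)
lookup-applyUpTo-toList (x ∷ X) f eq fzero = ∷-injectiveˡ eq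
lookup-applyUpTo-toList (x ∷ X) f eq (fsuc r) = lookup-applyUpTo-toList X (f ∘ suc) (∷-injectiveʳ eq) r

module _ {A : Set} (g : ℕ → A) where

  -- EndsAt w m: w = g (m − |w|) ⋯ g (m − 1), a suffix of the length-m prefix of g.
  data EndsAt : List A → ℕ → Set where
    empty  : ∀ m → EndsAt [] m
    extend : ∀ {w m} → EndsAt w m → EndsAt (w ∷ʳ g m) (suc m)

  endsAt-shift : ∀ δ {w m} → (∀ t → t < m → g t ≡ g (δ + t)) → EndsAt w m → EndsAt w (δ + m)
  endsAt-shift δ periodic (empty m) = empty (δ + m)
  endsAt-shift δ periodic (extend {w} {m} e) =
    subst (EndsAt (w ∷ʳ g m)) (sym (+-suc δ m))
      (subst (λ x → EndsAt (w ∷ʳ x) (suc (δ + m))) (sym (periodic m ≤-refl))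
        (extend (endsAt-shift δ (λ t t<m → periodic t (m<n⇒m<1+n t<m)) e)))

  endsAt-applyUpTo : ∀ {w m} → EndsAt w m →
                     ∃[ p ] p + length w ≡ m × w ≡ applyUpTo (g ∘ (p +_)) (length w)
  endsAt-applyUpTo (empty m) = m , +-identityʳ m , refl
  endsAt-applyUpTo (extend {w} e) with endsAt-applyUpTo e
  ... | p , refl , w≡ = p , trans (cong (p +_) length-snoc) (+-suc p n) , (begin
    w ∷ʳ f n                    ≡⟨ cong (_∷ʳ f n) w≡ ⟩
    applyUpTo f n ∷ʳ f n        ≡⟨ applyUpTo-∷ʳ f n ⟩
    applyUpTo f (suc n)         ≡⟨ cong (applyUpTo f) length-snoc ⟨
    applyUpTo f (length (w ∷ʳ f n)) ∎)
    where
    n = length w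
    f = g ∘ (p +_)
    length-snoc : length (w ∷ʳ f n) ≡ suc n
    length-snoc = trans (length-++ w) (+-comm n 1)

  endsAt-lookup : ∀ {n} {X : Vec A n} {m} → EndsAt (toList X) m → ∃[ p ] ∀ r → lookup X r ≡ g (p + toℕ r)
  endsAt-lookup {X = X} e with endsAt-applyUpTo e
  ... | p , _ , X≡ = p , lookup-applyUpTo-toList X (g ∘ (p +_)) X≡

module _ {A : Set} (label : Bool → A) where

  -- Shift the occurrence by the period F n, landing just before the parity letter.
  endsAt-jump : ∀ n {w} → EndsAt (label ∘ fibWord) w (F (suc n) ∸ 2) →
                EndsAt (label ∘ fibWord) (w ∷ʳ label (isEven (suc n))) (F (suc (suc n)) ∸ 1)
  endsAt-jump n {w} e =
    subst₂ (λ x m → EndsAt (label ∘ fibWord) (w ∷ʳ label x) m)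
           (fibWord-boundary n) (cong (_∸ 1) (length-fibStem n))
      (extend (subst (EndsAt (label ∘ fibWord) w) (sym (fibStem-length n))
        (endsAt-shift (label ∘ fibWord) (F n) (λ t t<m → cong label (fibWord-periodic n t<m)) e)))

rowLabel : Bool → RowL
rowLabel x = if x then D else C

colLabel : Bool → ColL
colLabel y = if y then D' else B

hEdge-endsAt : ∀ {u v x} → HEdge u v x → ∀ {w} →
               EndsAt (rowLabel ∘ fibWord) w (proj₂ u) → EndsAt (rowLabel ∘ fibWord) (w ∷ʳ x) (proj₂ v)
hEdge-endsAt (hstep j) e = extend e
hEdge-endsAt (hjump (suc n) _) e = endsAt-jump rowLabel n e

vEdge-endsAt : ∀ {u v y} → VEdge u v y → ∀ {w} →
               EndsAt (colLabel ∘ fibWord) w (proj₁ u) → EndsAt (colLabel ∘ fibWord) (w ∷ʳ y) (proj₁ v)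
vEdge-endsAt (vstep i j) e = extend e
vEdge-endsAt (vjump (suc n) j _) e = endsAt-jump colLabel n e

hWalk-endsAt : ∀ {u v n} {xs : Vec RowL n} → HWalk u v xs → ∀ {w} →
               EndsAt (rowLabel ∘ fibWord) w (proj₂ u) → EndsAt (rowLabel ∘ fibWord) (w ++ toList xs) (proj₂ v)
hWalk-endsAt hnil {w} e = subst (λ z → EndsAt _ z _) (sym (++-identityʳ w)) e
hWalk-endsAt (hcons {x = x} {xs = xs} edge walk) {w} e =
  subst (λ z → EndsAt _ z _) (∷ʳ-++ w x (toList xs)) (hWalk-endsAt walk (hEdge-endsAt edge e))

vWalk-endsAt : ∀ {u v n} {ys : Vec ColL n} → VWalk u v ys → ∀ {w} →
               EndsAt (colLabel ∘ fibWord) w (proj₁ u) → EndsAt (colLabel ∘ fibWord) (w ++ toList ys) (proj₁ v)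
vWalk-endsAt vnil {w} e = subst (λ z → EndsAt _ z _) (sym (++-identityʳ w)) e
vWalk-endsAt (vcons {y = y} {ys = ys} edge walk) {w} e =
  subst (λ z → EndsAt _ z _) (∷ʳ-++ w y (toList ys)) (vWalk-endsAt walk (vEdge-endsAt edge e))

hWalk-factor : ∀ {u v n} {X : Vec RowL n} → HWalk u v X → ∃[ p ] ∀ s → lookup X s ≡ rowLabel (fibWord (p + toℕ s))
hWalk-factor walk = endsAt-lookup (rowLabel ∘ fibWord) (hWalk-endsAt walk (empty _))

vWalk-factor : ∀ {u v n} {Y : Vec ColL n} → VWalk u v Y → ∃[ q ] ∀ r → lookup Y r ≡ colLabel (fibWord (q + toℕ r))
vWalk-factor walk = endsAt-lookup (colLabel ∘ fibWord) (vWalk-endsAt walk (empty _))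

letter : Bool → Bool → Letter
letter true  true  = d
letter true  false = c
letter false true  = b
letter false false = a

fAt≡letter : ∀ i j → fAt i j ≡ letter (xAt i) (xAt j)
fAt≡letter i j with xAt i | xAt j
... | true  | true  = refl
... | true  | false = refl
... | false | true  = refl
... | false | false = refl

rowBit : Letter → Bool
rowBit d = true
rowBit c = true
rowBit b = false
rowBit a = false

rowBit-letter : ∀ x y → rowBit (letter x y) ≡ x
rowBit-letter true  true  = refl
rowBit-letter true  false = refl
rowBit-letter false true  = refl
rowBit-letter false false = refl

letter-injectiveˡ : ∀ {x x′} y y′ → letter x y ≡ letter x′ y′ → x ≡ x′
letter-injectiveˡ {x} {x′} y y′ eq =
  trans (sym (rowBit-letter x y)) (trans (cong rowBit eq) (rowBit-letter x′ y′))

hMap-rowLabel : ∀ h x → hMap h (rowLabel x) ≡ letter h x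
hMap-rowLabel true  true  = refl
hMap-rowLabel true  false = refl
hMap-rowLabel false true  = refl
hMap-rowLabel false false = refl

vMap-colLabel : ∀ v y → vMap v (colLabel y) ≡ letter y v
vMap-colLabel true  true  = refl
vMap-colLabel true  false = refl
vMap-colLabel false true  = refl
vMap-colLabel false false = refl

θ-letter : ∀ x y → θ (letter x y) ≡ letter (not x) y
θ-letter true  true  = refl
θ-letter true  false = refl
θ-letter false true  = refl
θ-letter false false = refl

letter-row : ∀ v y₀ y z → (if letter y v ==L letter y₀ v then letter y₀ z else θ (letter y₀ z)) ≡ letter y z
letter-row true  true  true  z = refl
letter-row true  true  false z = θ-letter true z
letter-row true  false true  z = θ-letter false z
letter-row true  false false z = refl
letter-row false true  true  z = refl
letter-row false true  false z = θ-letter true z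
letter-row false false true  z = θ-letter false z
letter-row false false false z = refl

arrayU-letter : ∀ {k l} (H : Vec Letter l) (V : Vec Letter (suc k)) (h v : Bool)
                (α : Fin l → Bool) (β : Fin (suc k) → Bool) →
                (∀ s → lookup H s ≡ letter h (α s)) → (∀ r → lookup V r ≡ letter (β r) v) → h ≡ β fzero →
                ∀ r s → arrayU H V r s ≡ letter (β r) (α s)
arrayU-letter H V h v α β H≡ V≡ refl fzero s = H≡ s
arrayU-letter H (v₁ ∷ vs) h v α β H≡ V≡ refl (fsuc r) s
  rewrite V≡ (fsuc r) | V≡ fzero | H≡ s = letter-row v (β fzero) (β (fsuc r)) (α s)

last≡lookup-fromℕ : ∀ {A : Set} {n} (X : Vec A (suc n)) → last X ≡ lookup X (fromℕ n)
last≡lookup-fromℕ {n = zero} (x ∷ []) = refl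
last≡lookup-fromℕ {n = suc n} (x ∷ X) = last≡lookup-fromℕ X

fAt-+-suc : ∀ i j r s → fAt (i + suc r) (j + suc s) ≡ letter (fibWord (i + r)) (fibWord (j + s))
fAt-+-suc i j r s rewrite +-suc i r | +-suc j s = fAt≡letter (suc (i + r)) (suc (j + s))

mainTheorem1 : (k l : ℕ) (X : Vec RowL (suc l)) (Y : Vec ColL (suc k))
    (v w : Vertex) → HWalk (0 , 0) v X → VWalk v w Y →
    (hc vc : Bool) →
    last (map (hMap hc) X) ≡ head (map (vMap vc) Y) →
    IsFactor (suc k) (suc l) (arrayU (map (hMap hc) X) (map (vMap vc) Y))
mainTheorem1 k l X (y ∷ ys) v w hWalk vWalk hc vc last≡head = q , p , λ r s →
  trans (arrayU-letter H V hc vc α β H≡ V≡ hc≡β₀ r s) (sym (fAt-+-suc q p (toℕ r) (toℕ s)))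
  where
  H : Vec Letter (suc l)
  H = map (hMap hc) X
  V : Vec Letter (suc k)
  V = map (vMap vc) (y ∷ ys)
  p q : ℕ
  p = proj₁ (hWalk-factor hWalk)
  q = proj₁ (vWalk-factor vWalk)
  α : Fin (suc l) → Bool
  α s = fibWord (p + toℕ s)
  β : Fin (suc k) → Bool
  β r = fibWord (q + toℕ r)
  H≡ : ∀ s → lookup H s ≡ letter hc (α s)
  H≡ s = trans (lookup-map s (hMap hc) X)
               (trans (cong (hMap hc) (proj₂ (hWalk-factor hWalk) s)) (hMap-rowLabel hc (α s)))
  V≡ : ∀ r → lookup V r ≡ letter (β r) vc
  V≡ r = trans (lookup-map r (vMap vc) (y ∷ ys))
               (trans (cong (vMap vc) (proj₂ (vWalk-factor vWalk) r)) (vMap-colLabel vc (β r)))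
  hc≡β₀ : hc ≡ β fzero
  hc≡β₀ = letter-injectiveˡ (α (fromℕ l)) vc
    (trans (sym (H≡ (fromℕ l))) (trans (sym (last≡lookup-fromℕ H)) (trans last≡head (V≡ fzero))))
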